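{- Let $2 \le m \le n$ and let $G$ and $H$ be connected graphs of orders $m$ and $n$, respectively. For every integer $k \ge 1$, $$d_k(G \Box H) \ge \min\{\, n + \delta(G) - 1,\ m + \delta(H) - 1 \,\}.$$
   Context: $\delta(\cdot)$ is the minimum degree. $G \Box H$ is the Cartesian product: vertex set $V(G)\times V(H)$, with $(x,y)$ adjacent to $(u,v)$ iff ($x=u$ and $yv \in E(H)$) or ($xu \in E(G)$ and $y=v$). The $k$-move deduction game ($k$ a positive integer) on a finite graph $G$: a layout places a finite number of searchers on vertices of $G$ (several searchers may share a vertex). Every searcher is initially mobile. A vertex is protected once it has been occupied by some searcher (so initially occupied vertices are protected); other vertices are unprotected. The game proceeds in stages. At each stage, for every vertex $v$ that has at least one unprotected neighbour: if the number of mobile searchers on $v$ is at least the number of unprotected neighbours of $v$, then the mobile searchers on $v$ move to the unprotected neighbours of $v$ so that each unprotected neighbour receives at least one searcher; excess mobile searchers on $v$ may also move to any of these unprotected neighbours. All moves in a stage happen simultaneously, newly occupied vertices become protected, and a searcher that has moved $k$ times becomes immobile. The process repeats until all vertices are protected or no searcher can move. A layout is successful if all vertices of $G$ end up protected. The $k$-move deduction number $d_k(G)$ is the minimum number of searchers in a successful layout on $G$. -}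

module Defs where

open import Data.Nat using (ℕ; zero; suc; _+_; _*_; _⊓_; _<ᵇ_; _≤ᵇ_)
open import Data.Bool using (Bool; true; false; _∧_; _∨_; not)
open import Data.Fin using (Fin; zero; suc; remQuot)
open import Data.Fin.Properties using (_≟_)
open import Data.Product using (Σ; ∃; _×_; _,_; proj₁; proj₂)
open import Relation.Nullary.Decidable using (⌊_⌋)
open import Relation.Binary.PropositionalEquality using (_≡_)
open import Relation.Binary.Construct.Closure.ReflexiveTransitive using (Star)

Adjacency : ℕ → Set
Adjacency N = Fin N → Fin N → Bool

record IsSimple {N : ℕ} (A : Adjacency N) : Set where
  field
    sym   : ∀ u v → A u v ≡ A v u
    irrefl : ∀ v → A v v ≡ false

data Walk {N : ℕ} (A : Adjacency N) : Fin N → Fin N → Set where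
  here : ∀ {v} → Walk A v v
  step : ∀ {u w v} → A u w ≡ true → Walk A w v → Walk A u v

Connected : {N : ℕ} → Adjacency N → Set
Connected A = ∀ u v → Walk A u v

countF : {n : ℕ} → (Fin n → Bool) → ℕ
countF {zero} f = 0
countF {suc n} f = (if f zero then 1 else 0) + countF (λ i → f (suc i))
  where
  if_then_else_ : Bool → ℕ → ℕ → ℕ
  if true then a else b = a
  if false then a else b = b

anyF : {n : ℕ} → (Fin n → Bool) → Bool
anyF {zero} f = false
anyF {suc n} f = f zero ∨ anyF (λ i → f (suc i))

-- Minimum of a function over Fin n (0 for the empty vertex set).
minF : {n : ℕ} → (Fin n → ℕ) → ℕ
minF {zero} f = 0
minF {suc zero} f = f zero
minF {suc (suc n)} f = f zero ⊓ minF (λ i → f (suc i))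

degree : {N : ℕ} → Adjacency N → Fin N → ℕ
degree A v = countF (A v)

δ : {N : ℕ} → Adjacency N → ℕ
δ A = minF (degree A)

_==_ : {N : ℕ} → Fin N → Fin N → Bool
x == y = ⌊ x ≟ y ⌋

_□_ : {m n : ℕ} → Adjacency m → Adjacency n → Adjacency (m * n)
_□_ {m} {n} G H i j =
  let x = proj₁ (remQuot {m} n i) ; y = proj₂ (remQuot {m} n i)
      u = proj₁ (remQuot {m} n j) ; v = proj₂ (remQuot {m} n j)
  in ((x == u) ∧ H y v) ∨ (G x u ∧ (y == v))

-- The k-move deduction game with s searchers on a graph with N vertices.

record State (N s : ℕ) : Set where
  constructor state
  field
    pos  : Fin s → Fin N
    cnt  : Fin s → ℕ         -- number of moves made by each searcher
    prot : Fin N → Bool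

module Game {N : ℕ} (A : Adjacency N) (k : ℕ) {s : ℕ} (st : State N s) where
  open State st

  unprotNb : Fin N → Fin N → Bool
  unprotNb v w = A v w ∧ not (prot w)

  numUnprot : Fin N → ℕ
  numUnprot v = countF (unprotNb v)

  mobile : Fin s → Bool
  mobile i = cnt i <ᵇ k

  numMobile : Fin N → ℕ
  numMobile v = countF (λ i → (pos i == v) ∧ mobile i)

  fires : Fin N → Bool
  fires v = (0 <ᵇ numUnprot v) ∧ (numUnprot v ≤ᵇ numMobile v)

  moves : Fin s → Bool
  moves i = mobile i ∧ fires (pos i)

-- One stage of the game (all moves simultaneous).
record Step {N s : ℕ} (A : Adjacency N) (k : ℕ) (st st' : State N s) : Set where
  open Game A k st
  open State st
  open State st' renaming (pos to pos'; cnt to cnt'; prot to prot')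
  field
    moved  : ∀ i → moves i ≡ true →
               unprotNb (pos i) (pos' i) ≡ true × cnt' i ≡ suc (cnt i)
    stays  : ∀ i → moves i ≡ false → pos' i ≡ pos i × cnt' i ≡ cnt i
    covers : ∀ v w → fires v ≡ true → unprotNb v w ≡ true →
               ∃ λ i → pos i ≡ v × mobile i ≡ true × pos' i ≡ w
    protUpd : ∀ w → prot' w ≡ (prot w ∨ anyF (λ i → pos' i == w))

initial : {N s : ℕ} → (Fin s → Fin N) → State N s
initial {N} {s} layout = state layout (λ _ → 0) (λ w → anyF (λ i → layout i == w))

Successful : {N s : ℕ} → Adjacency N → ℕ → (Fin s → Fin N) → Set
Successful {N} {s} A k layout =
  Σ (State N s) λ st → Star (Step A k) (initial layout) st × (∀ w → State.prot st w ≡ true)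

{-# OPTIONS --safe #-}
module Submission where

-- Split G □ H into its m columns (copies of H) and its n rows (copies of G),
-- and follow a successful play stage by stage, remembering the set F of
-- vertices that have fired so far.  Consider the first stage at which every
-- column contains a protected vertex and some vertex fires on a column where
-- nothing has fired before.  Every column then carries a searcher (walk inside
-- the column from a protected vertex towards a vertex outside F), and the
-- firing column carries at least δ(H) of them: the firing vertex holds one
-- searcher per unprotected neighbour, and each protected neighbour in the
-- column is occupied because it lies outside F.  Hence s ≥ (m - 1) + δ(H), and
-- symmetrically for rows.  If neither event ever happens, then at the end some
-- column and some row both avoid F and were empty initially, and the vertex
-- where they cross could never have been protected.

open import Defs
open import Data.Nat using (ℕ; _≤_; _+_; _*_; _∸_; _⊓_)
open import Data.Fin using (Fin)

open import Data.Nat.Properties using (+-0-commutativeMonoid)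
open import Algebra.Properties.CommutativeMonoid.Sum +-0-commutativeMonoid
  using (sum; sum-cong-≗; sum-replicate-zero; sum-remove; ∑-comm; ∑-distrib-+)
open import Data.Bool using (Bool; true; false; _∧_; _∨_; not)
import Data.Bool as Bool
open import Data.Bool.Properties
  using (∧-conicalˡ; ∧-conicalʳ; ∨-conicalˡ; ∨-conicalʳ; ∨-identityʳ; ∧-zeroʳ; ∧-identityʳ; ¬-not; not-¬; T-≡)
open import Data.Empty using (⊥-elim)
open import Data.Fin using (zero; suc; combine; remQuot; punchIn)
open import Data.Fin.Properties using (_≟_; remQuot-combine; combine-remQuot; punchInᵢ≢i; any?; all?; ¬∀⟶∃¬)
open import Data.Nat using (zero; suc; _<_; z≤n; s≤s)
open import Data.Nat.Properties
  using (≤-refl; ≤-trans; ≤-antisym; +-comm; +-mono-≤; m⊓n≤m; m⊓n≤n; ≤ᵇ⇒≤; <ᵇ⇒<; module ≤-Reasoning)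
open import Data.Product using (∃; _×_; _,_; proj₁; proj₂; map; map₂)
open import Data.Sum using (_⊎_; inj₁; inj₂; [_,_]′)
open import Data.Vec.Functional using (removeAt)
open import Function using (_∘_; id; Equivalence)
open import Relation.Binary.Construct.Closure.ReflexiveTransitive using (Star; ε; _◅_)
open import Relation.Binary.PropositionalEquality
  using (_≡_; _≢_; refl; sym; trans; cong; cong₂; subst; module ≡-Reasoning)
open import Relation.Nullary using (¬_; Dec; yes; no)
open import Relation.Nullary.Decidable using (_×-dec_)

open State using (pos; prot)

∨-true : ∀ x {y} → x ∨ y ≡ true → x ≡ true ⊎ y ≡ true
∨-true true  _ = inj₁ refl
∨-true false p = inj₂ p

∨-trueʳ : ∀ x {y} → y ≡ true → x ∨ y ≡ true
∨-trueʳ true  _ = refl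
∨-trueʳ false p = p

contra-false : ∀ {b c} → (b ≡ true → c ≡ true) → c ≡ false → b ≡ false
contra-false {false} _ _ = refl
contra-false {true}  h c≡false = ⊥-elim (not-¬ c≡false (h refl))

==⇒≡ : ∀ {N} {x y : Fin N} → (x == y) ≡ true → x ≡ y
==⇒≡ {x = x} {y} p with x ≟ y
... | yes x≡y = x≡y

≡⇒== : ∀ {N} {x y : Fin N} → x ≡ y → (x == y) ≡ true
≡⇒== {x = x} {y} x≡y with x ≟ y
... | yes _   = refl
... | no x≢y = ⊥-elim (x≢y x≡y)

≢⇒== : ∀ {N} {x y : Fin N} → x ≢ y → (x == y) ≡ false
≢⇒== {x = x} {y} x≢y with x ≟ y
... | yes x≡y = ⊥-elim (x≢y x≡y)
... | no _    = refl

==-refl : ∀ {N} (x : Fin N) → (x == x) ≡ true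
==-refl x = ≡⇒== refl

anyF-intro : ∀ {n} (f : Fin n → Bool) j → f j ≡ true → anyF f ≡ true
anyF-intro f zero    p = cong (_∨ anyF (f ∘ suc)) p
anyF-intro f (suc j) p = ∨-trueʳ (f zero) (anyF-intro (f ∘ suc) j p)

anyF-elim : ∀ {n} (f : Fin n → Bool) → anyF f ≡ true → ∃ λ j → f j ≡ true
anyF-elim {suc n} f p with ∨-true (f zero) p
... | inj₁ q = zero , q
... | inj₂ q = map suc id (anyF-elim (f ∘ suc) q)

boolToℕ : Bool → ℕ
boolToℕ true  = 1
boolToℕ false = 0

countF≡sum : ∀ {n} (f : Fin n → Bool) → countF f ≡ sum (boolToℕ ∘ f)
countF≡sum {zero}  f = refl
countF≡sum {suc n} f with f zero
... | true  = cong suc (countF≡sum (f ∘ suc))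
... | false = countF≡sum (f ∘ suc)

sum-mono-≤ : ∀ {n} {f g : Fin n → ℕ} → (∀ i → f i ≤ g i) → sum f ≤ sum g
sum-mono-≤ {zero}  f≤g = z≤n
sum-mono-≤ {suc n} f≤g = +-mono-≤ (f≤g zero) (sum-mono-≤ (f≤g ∘ suc))

countF-mono : ∀ {n} {f g : Fin n → Bool} → (∀ i → f i ≡ true → g i ≡ true) → countF f ≤ countF g
countF-mono {f = f} {g} f⇒g = begin
  countF f          ≡⟨ countF≡sum f ⟩
  sum (boolToℕ ∘ f) ≤⟨ sum-mono-≤ (λ i → boolToℕ-mono (f⇒g i)) ⟩
  sum (boolToℕ ∘ g) ≡⟨ countF≡sum g ⟨
  countF g          ∎
  where
  open ≤-Reasoning
  boolToℕ-mono : ∀ {a b} → (a ≡ true → b ≡ true) → boolToℕ a ≤ boolToℕ b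
  boolToℕ-mono {false}     _   = z≤n
  boolToℕ-mono {true}  a⇒b rewrite a⇒b refl = ≤-refl

countF-cong : ∀ {n} {f g : Fin n → Bool} → (∀ i → f i ≡ g i) → countF f ≡ countF g
countF-cong f≗g = ≤-antisym (countF-mono (λ i → trans (sym (f≗g i)))) (countF-mono (λ i → trans (f≗g i)))

countF-true : ∀ n → countF {n} (λ _ → true) ≡ n
countF-true zero    = refl
countF-true (suc n) = cong suc (countF-true n)

countF-witness : ∀ {n} (f : Fin n → Bool) → 0 < countF f → ∃ λ j → f j ≡ true
countF-witness {suc n} f 0<count with f zero in eq
... | true  = zero , eq
... | false = map suc id (countF-witness (f ∘ suc) 0<count)

countF-singleton : ∀ {n} (x : Fin n) → countF (x ==_) ≡ 1
countF-singleton {suc n} x = begin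
  countF (x ==_)                                          ≡⟨ countF≡sum (x ==_) ⟩
  sum (boolToℕ ∘ (x ==_))                                 ≡⟨ sum-remove (boolToℕ ∘ (x ==_)) ⟩
  boolToℕ (x == x) + sum (removeAt (boolToℕ ∘ (x ==_)) x) ≡⟨ cong (λ b → boolToℕ b + sum (removeAt (boolToℕ ∘ (x ==_)) x)) (==-refl x) ⟩
  1 + sum (removeAt (boolToℕ ∘ (x ==_)) x)                 ≡⟨ cong (1 +_) (trans (sum-cong-≗ others) (sum-replicate-zero n)) ⟩
  1                                                       ∎
  where
  open ≡-Reasoning
  others : ∀ i → boolToℕ (x == punchIn x i) ≡ 0
  others i = cong boolToℕ (≢⇒== (punchInᵢ≢i x i ∘ sym))

countF-≥1 : ∀ {n} (f : Fin n → Bool) j → f j ≡ true → 1 ≤ countF f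
countF-≥1 f j fj = subst (_≤ countF f) (countF-singleton j)
  (countF-mono {f = j ==_} {f} λ i j==i → subst (λ x → f x ≡ true) (==⇒≡ j==i) fj)

countF-split : ∀ {n} (f g : Fin n → Bool) →
  countF f ≡ countF (λ i → f i ∧ not (g i)) + countF (λ i → f i ∧ g i)
countF-split f g = begin
  countF f                                                        ≡⟨ countF≡sum f ⟩
  sum (boolToℕ ∘ f)                                               ≡⟨ sum-cong-≗ (λ i → split (f i) (g i)) ⟩
  sum (λ i → boolToℕ (f i ∧ not (g i)) + boolToℕ (f i ∧ g i))
    ≡⟨ ∑-distrib-+ (λ i → boolToℕ (f i ∧ not (g i))) (λ i → boolToℕ (f i ∧ g i)) ⟩
  sum (λ i → boolToℕ (f i ∧ not (g i))) + sum (λ i → boolToℕ (f i ∧ g i))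
    ≡⟨ cong₂ _+_ (countF≡sum (λ i → f i ∧ not (g i))) (countF≡sum (λ i → f i ∧ g i)) ⟨
  countF (λ i → f i ∧ not (g i)) + countF (λ i → f i ∧ g i)       ∎
  where
  open ≡-Reasoning
  split : ∀ a b → boolToℕ a ≡ boolToℕ (a ∧ not b) + boolToℕ (a ∧ b)
  split false _     = refl
  split true  false = refl
  split true  true  = refl

countF-partition : ∀ {n L} (p : Fin n → Bool) (g : Fin n → Fin L) →
  countF p ≡ sum (λ ℓ → countF (λ i → p i ∧ (g i == ℓ)))
countF-partition p g = begin
  countF p                                            ≡⟨ countF≡sum p ⟩
  sum (boolToℕ ∘ p)                                   ≡⟨ sum-cong-≗ (λ i → sum-indicator (p i) (g i)) ⟨
  sum (λ i → sum (λ ℓ → boolToℕ (p i ∧ (g i == ℓ))))  ≡⟨ ∑-comm (λ i ℓ → boolToℕ (p i ∧ (g i == ℓ))) ⟩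
  sum (λ ℓ → sum (λ i → boolToℕ (p i ∧ (g i == ℓ))))  ≡⟨ sum-cong-≗ (λ ℓ → countF≡sum (λ i → p i ∧ (g i == ℓ))) ⟨
  sum (λ ℓ → countF (λ i → p i ∧ (g i == ℓ)))         ∎
  where
  open ≡-Reasoning
  sum-indicator : ∀ {L} b (x : Fin L) → sum (λ ℓ → boolToℕ (b ∧ (x == ℓ))) ≡ boolToℕ b
  sum-indicator {L} false x = sum-replicate-zero L
  sum-indicator true  x = trans (sym (countF≡sum (x ==_))) (countF-singleton x)

countF-∘-≤ : ∀ {K N} (p : Fin N → Bool) (e : Fin K → Fin N) (r : Fin N → Fin K) →
  (∀ a → r (e a) ≡ a) → countF (p ∘ e) ≤ countF p
countF-∘-≤ p e r r∘e≗id = begin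
  countF (p ∘ e)                               ≡⟨ countF≡sum (p ∘ e) ⟩
  sum (boolToℕ ∘ p ∘ e)                        ≤⟨ sum-mono-≤ hit ⟩
  sum (λ a → countF (λ w → p w ∧ (r w == a)))  ≡⟨ countF-partition p r ⟨
  countF p                                     ∎
  where
  open ≤-Reasoning
  hit : ∀ a → boolToℕ (p (e a)) ≤ countF (λ w → p w ∧ (r w == a))
  hit a with p (e a) in pe
  ... | false = z≤n
  ... | true  = countF-≥1 (λ w → p w ∧ (r w == a)) (e a) (cong₂ _∧_ pe (≡⇒== (r∘e≗id a)))

sum-const-1 : ∀ n → sum {n} (λ _ → 1) ≡ n
sum-const-1 n = trans (sym (countF≡sum {n} (λ _ → true))) (countF-true n)

L∸1+x≤sum : ∀ {L} (c : Fin L → ℕ) j {x} → (∀ ℓ → 1 ≤ c ℓ) → x ≤ c j → (L ∸ 1) + x ≤ sum c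
L∸1+x≤sum {suc L} c j {x} c≥1 x≤cj = begin
  L + x                           ≡⟨ +-comm L x ⟩
  x + L                           ≡⟨ cong (x +_) (sum-const-1 L) ⟨
  x + sum {L} (λ _ → 1)           ≤⟨ +-mono-≤ x≤cj (sum-mono-≤ (c≥1 ∘ punchIn j)) ⟩
  c j + sum (removeAt c j)        ≡⟨ sum-remove c ⟨
  sum c                           ∎
  where open ≤-Reasoning

degree≤sum : ∀ {K} (B : Adjacency K) (P : Fin K → Bool) (c : Fin K → ℕ) a → B a a ≡ false →
  countF (λ b → B a b ∧ not (P b)) ≤ c a → (∀ b → B a b ∧ P b ≡ true → 1 ≤ c b) →
  degree B a ≤ sum c
degree≤sum {suc K} B P c a irrefl U≤ca protected⇒1≤c = begin
  degree B a                                    ≡⟨ countF-split (B a) P ⟩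
  U + countF (λ b → B a b ∧ P b)                ≡⟨ cong (U +_) (countF≡sum (λ b → B a b ∧ P b)) ⟩
  U + sum d                                     ≡⟨ cong (U +_) (sum-remove d) ⟩
  U + (d a + sum (removeAt d a))                ≡⟨ cong (λ x → U + (boolToℕ (x ∧ P a) + sum (removeAt d a))) irrefl ⟩
  U + sum (removeAt d a)                        ≤⟨ +-mono-≤ U≤ca (sum-mono-≤ (d≤c ∘ punchIn a)) ⟩
  c a + sum (removeAt c a)                      ≡⟨ sum-remove c ⟨
  sum c                                         ∎
  where
  open ≤-Reasoning
  U = countF (λ b → B a b ∧ not (P b))
  d : Fin (suc K) → ℕ
  d b = boolToℕ (B a b ∧ P b)
  d≤c : ∀ b → d b ≤ c b
  d≤c b with B a b ∧ P b in e
  ... | true  = protected⇒1≤c b e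
  ... | false = z≤n

minF-≤ : ∀ {n} (f : Fin n → ℕ) i → minF f ≤ f i
minF-≤ {suc zero}    f zero    = ≤-refl
minF-≤ {suc (suc n)} f zero    = m⊓n≤m (f zero) _
minF-≤ {suc (suc n)} f (suc i) = ≤-trans (m⊓n≤n (f zero) _) (minF-≤ (f ∘ suc) i)

module Play {N : ℕ} (A : Adjacency N) (k : ℕ) {s : ℕ} (layout : Fin s → Fin N) where

  prot₀ : Fin N → Bool
  prot₀ = prot (initial layout)

  searchersAt : State N s → Fin N → ℕ
  searchersAt st v = countF (λ i → pos st i == v)

  fires : State N s → Fin N → Bool
  fires st = Game.fires A k st

  nextFired : State N s → (Fin N → Bool) → Fin N → Bool
  nextFired st F w = F w ∨ fires st w

  -- F is the set of vertices that have fired at some earlier stage.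
  record Invariant (st : State N s) (F : Fin N → Bool) : Set where
    field
      occupied⇒protected   : ∀ i → prot st (pos st i) ≡ true
      unfired⇒occupied     : ∀ w → prot st w ≡ true → F w ≡ false → ∃ λ i → pos st i ≡ w
      fired⇒nbrs-protected : ∀ w z → F w ≡ true → A w z ≡ true → prot st z ≡ true
      fired⇒protected      : ∀ w → F w ≡ true → prot st w ≡ true
      protected⇒reached    : ∀ w → prot st w ≡ true →
                               prot₀ w ≡ true ⊎ ∃ λ u → F u ≡ true × A u w ≡ true
      initial⇒protected    : ∀ w → prot₀ w ≡ true → prot st w ≡ true

  open Invariant

  invariant-initial : Invariant (initial layout) (λ _ → false)
  invariant-initial = record
    { occupied⇒protected   = λ i → anyF-intro _ i (==-refl (layout i))
    ; unfired⇒occupied     = λ w p _ → map₂ ==⇒≡ (anyF-elim _ p)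
    ; fired⇒nbrs-protected = λ _ _ ()
    ; fired⇒protected      = λ _ ()
    ; protected⇒reached    = λ _ → inj₁
    ; initial⇒protected    = λ _ → id
    }

  unprotected≤searchersAt : ∀ st v → fires st v ≡ true → Game.numUnprot A k st v ≤ searchersAt st v
  unprotected≤searchersAt st v firing = ≤-trans
    (≤ᵇ⇒≤ _ _ (Equivalence.from T-≡ (∧-conicalʳ _ _ firing)))
    (countF-mono (λ i → ∧-conicalˡ (pos st i == v) _))

  occupied⇒1≤searchersAt : ∀ {st v} → (∃ λ i → pos st i ≡ v) → 1 ≤ searchersAt st v
  occupied⇒1≤searchersAt {st} {v} (i , pos≡v) = countF-≥1 (λ j → pos st j == v) i (≡⇒== pos≡v)

  firing⇒occupied : ∀ st v → fires st v ≡ true → ∃ λ i → pos st i ≡ v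
  firing⇒occupied st v firing = map₂ ==⇒≡ (countF-witness (λ i → pos st i == v)
    (≤-trans (<ᵇ⇒< 0 _ (Equivalence.from T-≡ (∧-conicalˡ _ _ firing))) (unprotected≤searchersAt st v firing)))

  module _ {st st′ : State N s} (stage : Step A k st st′) where

    protected-mono : ∀ w → prot st w ≡ true → prot st′ w ≡ true
    protected-mono w p = trans (Step.protUpd stage w) (cong (_∨ _) p)

    arrival-protected : ∀ i → prot st′ (pos st′ i) ≡ true
    arrival-protected i = trans (Step.protUpd stage (pos st′ i))
      (∨-trueʳ (prot st (pos st′ i)) (anyF-intro _ i (==-refl (pos st′ i))))

    newly-protected⇒arrival : ∀ w → prot st w ≡ false → prot st′ w ≡ true → ∃ λ i → pos st′ i ≡ w
    newly-protected⇒arrival w unprot prot′ =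
      map₂ ==⇒≡ (anyF-elim _ (trans (sym (trans (Step.protUpd stage w) (cong (_∨ _) unprot))) prot′))

    stays-put : ∀ i → fires st (pos st i) ≡ false → pos st′ i ≡ pos st i
    stays-put i idle = proj₁ (Step.stays stage i (contra-false (∧-conicalʳ (Game.mobile A k st i) _) idle))

    arrived-from-firing : ∀ i → prot st (pos st i) ≡ true → prot st (pos st′ i) ≡ false →
                          fires st (pos st i) ≡ true × A (pos st i) (pos st′ i) ≡ true
    arrived-from-firing i was-protected newly with Game.moves A k st i in moves
    ... | true  = ∧-conicalʳ (Game.mobile A k st i) _ moves , ∧-conicalˡ _ _ (proj₁ (Step.moved stage i moves))
    ... | false with trans (sym (subst (λ w → prot st w ≡ true) (sym (proj₁ (Step.stays stage i moves))) was-protected)) newly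
    ...   | ()

  firing⇒protected : ∀ {st F} → Invariant st F → ∀ v → fires st v ≡ true → prot st v ≡ true
  firing⇒protected {st} I v firing with firing⇒occupied st v firing
  ... | i , refl = occupied⇒protected I i

  invariant-step : ∀ {st st′ F} → Step A k st st′ → Invariant st F → Invariant st′ (nextFired st F)
  invariant-step {st} {st′} {F} stage I = record
    { occupied⇒protected   = arrival-protected stage
    ; unfired⇒occupied     = unfired⇒occupied′
    ; fired⇒nbrs-protected = fired⇒nbrs-protected′
    ; fired⇒protected      = fired⇒protected′
    ; protected⇒reached    = protected⇒reached′
    ; initial⇒protected    = λ w → protected-mono stage w ∘ initial⇒protected I w
    }
    where
    unfired⇒occupied′ : ∀ w → prot st′ w ≡ true → nextFired st F w ≡ false → ∃ λ i → pos st′ i ≡ w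
    unfired⇒occupied′ w p′ unfired with prot st w in p
    ... | false = newly-protected⇒arrival stage w p p′
    ... | true with unfired⇒occupied I w p (∨-conicalˡ (F w) _ unfired)
    ...   | i , refl = i , stays-put stage i (∨-conicalʳ (F w) _ unfired)

    fired⇒nbrs-protected′ : ∀ w z → nextFired st F w ≡ true → A w z ≡ true → prot st′ z ≡ true
    fired⇒nbrs-protected′ w z fired adj with ∨-true (F w) fired | prot st z in p
    ... | inj₁ old    | _     = protected-mono stage z (fired⇒nbrs-protected I w z old adj)
    ... | inj₂ _      | true  = protected-mono stage z p
    ... | inj₂ firing | false with Step.covers stage w z firing (cong₂ _∧_ adj (cong not p))
    ...   | i , _ , _ , refl = arrival-protected stage i

    fired⇒protected′ : ∀ w → nextFired st F w ≡ true → prot st′ w ≡ true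
    fired⇒protected′ w fired with ∨-true (F w) fired
    ... | inj₁ old    = protected-mono stage w (fired⇒protected I w old)
    ... | inj₂ firing = protected-mono stage w (firing⇒protected I w firing)

    protected⇒reached′ : ∀ w → prot st′ w ≡ true →
                         prot₀ w ≡ true ⊎ ∃ λ u → nextFired st F u ≡ true × A u w ≡ true
    protected⇒reached′ w p′ with prot st w in p
    ... | true with protected⇒reached I w p
    ...   | inj₁ initial         = inj₁ initial
    ...   | inj₂ (u , Fu , adj)  = inj₂ (u , cong (_∨ _) Fu , adj)
    protected⇒reached′ w p′ | false with newly-protected⇒arrival stage w p p′
    ...   | i , refl with arrived-from-firing stage i (occupied⇒protected I i) p
    ...     | firing , adj = inj₂ (pos st i , ∨-trueʳ (F (pos st i)) firing , adj)

-- Abstracts the columns and the rows of G □ H: a partition of the vertices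
-- into L induced copies of one graph Line.
record LineDecomposition {N : ℕ} (A : Adjacency N) : Set where
  field
    L K            : ℕ
    Line           : Adjacency K
    pt             : Fin L → Fin K → Fin N
    line           : Fin N → Fin L
    coord          : Fin N → Fin K
    line-pt        : ∀ ℓ a → line (pt ℓ a) ≡ ℓ
    coord-pt       : ∀ ℓ a → coord (pt ℓ a) ≡ a
    pt-line-coord  : ∀ w → pt (line w) (coord w) ≡ w
    along          : ∀ ℓ a b → A (pt ℓ a) (pt ℓ b) ≡ Line a b
    Line-irrefl    : ∀ a → Line a a ≡ false
    Line-connected : Connected Line

module Lines {N : ℕ} {A : Adjacency N} (D : LineDecomposition A)
             (k : ℕ) {s : ℕ} (layout : Fin s → Fin N) where
  open LineDecomposition D
  open Play A k layout
  open Invariant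

  load : State N s → Fin L → ℕ
  load st ℓ = countF (λ i → line (pos st i) == ℓ)

  sum-load : ∀ st → sum (load st) ≡ s
  sum-load st = trans (sym (countF-partition (λ _ → true) (line ∘ pos st))) (countF-true s)

  on-line-at : ∀ w ℓ a → (line w == ℓ) ∧ (coord w == a) ≡ (w == pt ℓ a)
  on-line-at w ℓ a with w ≟ pt ℓ a
  ... | yes refl = cong₂ _∧_ (≡⇒== (line-pt ℓ a)) (≡⇒== (coord-pt ℓ a))
  ... | no w≢pt = ¬-not λ both → w≢pt (trans (sym (pt-line-coord w))
                    (cong₂ pt (==⇒≡ (∧-conicalˡ _ _ both)) (==⇒≡ (∧-conicalʳ _ _ both))))

  load≡sum-searchersAt : ∀ st ℓ → load st ℓ ≡ sum (λ a → searchersAt st (pt ℓ a))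
  load≡sum-searchersAt st ℓ = trans (countF-partition _ (coord ∘ pos st))
    (sum-cong-≗ (λ a → countF-cong (λ i → on-line-at (pos st i) ℓ a)))

  occupied⇒1≤load : ∀ st ℓ a → (∃ λ i → pos st i ≡ pt ℓ a) → 1 ≤ load st ℓ
  occupied⇒1≤load st ℓ a (i , pos≡pt) =
    countF-≥1 (λ j → line (pos st j) == ℓ) i (≡⇒== (trans (cong line pos≡pt) (line-pt ℓ a)))

  load-bound : ∀ st ℓ₀ → (∀ ℓ → 1 ≤ load st ℓ) → δ Line ≤ load st ℓ₀ → (L ∸ 1) + δ Line ≤ s
  load-bound st ℓ₀ 1≤load δ≤load =
    subst ((L ∸ 1) + δ Line ≤_) (sum-load st) (L∸1+x≤sum (load st) ℓ₀ 1≤load δ≤load)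

  Covered : State N s → Set
  Covered st = ∀ ℓ → ∃ λ a → prot st (pt ℓ a) ≡ true

  FreshFiring : State N s → (Fin N → Bool) → Set
  FreshFiring st F = ∃ λ ℓ → (∃ λ a → fires st (pt ℓ a) ≡ true) × (∀ a → F (pt ℓ a) ≡ false)

  UntouchedLine : (Fin N → Bool) → Fin L → Set
  UntouchedLine F ℓ = ∀ a → F (pt ℓ a) ≡ false × prot₀ (pt ℓ a) ≡ false

  Untouched : (Fin N → Bool) → Set
  Untouched F = (∀ w → F w ≡ false) ⊎ ∃ (UntouchedLine F)

  -- Fired vertices have all their neighbours protected, so a walk that starts
  -- at a protected vertex stays protected until it leaves F.
  protected-unfired-on-walk : ∀ {st F} → Invariant st F → ∀ ℓ {a b} → Walk Line a b →
    prot st (pt ℓ a) ≡ true → F (pt ℓ b) ≡ false → ∃ λ c → prot st (pt ℓ c) ≡ true × F (pt ℓ c) ≡ false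
  protected-unfired-on-walk I ℓ here p unfired = _ , p , unfired
  protected-unfired-on-walk {F = F} I ℓ {a} (step {w = c} adj walk) p unfired with F (pt ℓ a) in Fa
  ... | false = a , p , Fa
  ... | true  = protected-unfired-on-walk I ℓ walk
                  (fired⇒nbrs-protected I _ _ Fa (trans (along ℓ a c) adj)) unfired

  fresh-firing-bound : ∀ {st F} → Invariant st F → (∀ ℓ → ∃ λ a → F (pt ℓ a) ≡ false) →
    Covered st → FreshFiring st F → (L ∸ 1) + δ Line ≤ s
  fresh-firing-bound {st} {F} I unfired covered (ℓ₀ , (a₀ , firing) , fresh) = load-bound st ℓ₀ 1≤load (begin
    δ Line                                ≤⟨ minF-≤ (degree Line) a₀ ⟩
    degree Line a₀                        ≤⟨ degree≤sum Line (λ b → prot st (pt ℓ₀ b)) (λ b → searchersAt st (pt ℓ₀ b))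
                                                        a₀ (Line-irrefl a₀) unprotected≤ protected⇒1≤ ⟩
    sum (λ b → searchersAt st (pt ℓ₀ b))  ≡⟨ load≡sum-searchersAt st ℓ₀ ⟨
    load st ℓ₀                            ∎)
    where
    open ≤-Reasoning

    1≤load : ∀ ℓ → 1 ≤ load st ℓ
    1≤load ℓ with protected-unfired-on-walk I ℓ (Line-connected _ _) (proj₂ (covered ℓ)) (proj₂ (unfired ℓ))
    ... | c , p , Fc = occupied⇒1≤load st ℓ c (unfired⇒occupied I _ p Fc)

    v = pt ℓ₀ a₀

    unprotected≤ : countF (λ b → Line a₀ b ∧ not (prot st (pt ℓ₀ b))) ≤ searchersAt st v
    unprotected≤ = begin
      countF (λ b → Line a₀ b ∧ not (prot st (pt ℓ₀ b)))      ≡⟨ countF-cong (λ b → cong (_∧ _) (along ℓ₀ a₀ b)) ⟨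
      countF (λ b → A v (pt ℓ₀ b) ∧ not (prot st (pt ℓ₀ b)))  ≤⟨ countF-∘-≤ (λ w → A v w ∧ not (prot st w)) (pt ℓ₀) coord (coord-pt ℓ₀) ⟩
      Game.numUnprot A k st v                                 ≤⟨ unprotected≤searchersAt st v firing ⟩
      searchersAt st v                                        ∎

    protected⇒1≤ : ∀ b → Line a₀ b ∧ prot st (pt ℓ₀ b) ≡ true → 1 ≤ searchersAt st (pt ℓ₀ b)
    protected⇒1≤ b adj∧p = occupied⇒1≤searchersAt {st} (unfired⇒occupied I (pt ℓ₀ b) (∧-conicalʳ (Line a₀ b) _ adj∧p) (fresh b))

  saturated-bound : ∀ st → Fin L → Fin K → (∀ w → ∃ λ i → pos st i ≡ w) → (L ∸ 1) + δ Line ≤ s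
  saturated-bound st ℓ₀ a₀ occupied =
    load-bound st ℓ₀ (λ ℓ → occupied⇒1≤load st ℓ a₀ (occupied _)) (begin
    δ Line                                  ≤⟨ minF-≤ (degree Line) a₀ ⟩
    degree Line a₀                          ≤⟨ countF-mono {K} {Line a₀} {λ _ → true} (λ _ _ → refl) ⟩
    countF {K} (λ _ → true)                 ≡⟨ trans (countF-true K) (sym (sum-const-1 K)) ⟩
    sum {K} (λ _ → 1)                       ≤⟨ sum-mono-≤ (λ a → occupied⇒1≤searchersAt {st} (occupied (pt ℓ₀ a))) ⟩
    sum (λ a → searchersAt st (pt ℓ₀ a))    ≡⟨ load≡sum-searchersAt st ℓ₀ ⟨
    load st ℓ₀                              ∎)
    where open ≤-Reasoning

  covered? : ∀ st → Dec (Covered st)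
  covered? st = all? λ ℓ → any? λ a → prot st (pt ℓ a) Bool.≟ true

  freshFiring? : ∀ st F → Dec (FreshFiring st F)
  freshFiring? st F = any? λ ℓ →
    any? (λ a → fires st (pt ℓ a) Bool.≟ true) ×-dec all? (λ a → F (pt ℓ a) Bool.≟ false)

  uncovered-line : ∀ st → ¬ Covered st → ∃ λ ℓ → ∀ a → prot st (pt ℓ a) ≡ false
  uncovered-line st ¬covered = map₂ (λ ¬p a → ¬-not (¬p ∘ (a ,_)))
    (¬∀⟶∃¬ L _ (λ ℓ → any? λ a → prot st (pt ℓ a) Bool.≟ true) ¬covered)

  unprotected⇒untouched : ∀ {st F w} → Invariant st F → prot st w ≡ false →
    nextFired st F w ≡ false × prot₀ w ≡ false
  unprotected⇒untouched I unprot =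
    cong₂ _∨_ (contra-false (fired⇒protected I _) unprot) (contra-false (firing⇒protected I _) unprot) ,
    contra-false (initial⇒protected I _) unprot

  untouched-preserved : ∀ {st F} → ¬ FreshFiring st F → Untouched F → Untouched (nextFired st F)
  untouched-preserved {st} ¬fresh (inj₁ none) = inj₁ λ w → cong₂ _∨_ (none w) (¬-not λ firing →
    ¬fresh (line w , (coord w , subst (λ u → fires st u ≡ true) (sym (pt-line-coord w)) firing) , λ _ → none _))
  untouched-preserved ¬fresh (inj₂ (ℓ , untouched)) = inj₂ (ℓ , λ a →
    cong₂ _∨_ (proj₁ (untouched a)) (¬-not λ firing → ¬fresh (ℓ , (a , firing) , proj₁ ∘ untouched)) ,
    proj₂ (untouched a))

  -- A line without protected vertices is untouched after the stage, and
  -- without a fresh firing a line free of F stays free of F.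
  advance : ∀ {st F} → Invariant st F → Untouched F →
    (Covered st × FreshFiring st F) ⊎ Untouched (nextFired st F)
  advance {st} {F} I untouched with covered? st
  ... | no ¬covered = let (ℓ , unprotected) = uncovered-line st ¬covered in
                      inj₂ (inj₂ (ℓ , λ a → unprotected⇒untouched I (unprotected a)))
  ... | yes covered with freshFiring? st F
  ...   | yes fresh  = inj₁ (covered , fresh)
  ...   | no ¬fresh  = inj₂ (untouched-preserved ¬fresh untouched)

module _ {m n : ℕ} {G : Adjacency m} {H : Adjacency n}
         (simpleG : IsSimple G) (simpleH : IsSimple H) (connG : Connected G) (connH : Connected H) where

  □-combine : ∀ x y u v → (G □ H) (combine x y) (combine u v) ≡ ((x == u) ∧ H y v) ∨ (G x u ∧ (y == v))
  □-combine x y u v = cong₂ adj (remQuot-combine x y) (remQuot-combine u v)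
    where
    adj : Fin m × Fin n → Fin m × Fin n → Bool
    adj (x , y) (u , v) = ((x == u) ∧ H y v) ∨ (G x u ∧ (y == v))

  column-adjacency : ∀ x a b → (G □ H) (combine x a) (combine x b) ≡ H a b
  column-adjacency x a b = begin
    (G □ H) (combine x a) (combine x b)      ≡⟨ □-combine x a x b ⟩
    ((x == x) ∧ H a b) ∨ (G x x ∧ (a == b))  ≡⟨ cong₂ (λ e g → (e ∧ H a b) ∨ (g ∧ (a == b)))
                                                      (==-refl x) (IsSimple.irrefl simpleG x) ⟩
    H a b ∨ false                            ≡⟨ ∨-identityʳ (H a b) ⟩
    H a b                                    ∎
    where open ≡-Reasoning

  row-adjacency : ∀ y a b → (G □ H) (combine a y) (combine b y) ≡ G a b
  row-adjacency y a b = begin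
    (G □ H) (combine a y) (combine b y)      ≡⟨ □-combine a y b y ⟩
    ((a == b) ∧ H y y) ∨ (G a b ∧ (y == y))  ≡⟨ cong₂ (λ h e → ((a == b) ∧ h) ∨ (G a b ∧ e))
                                                      (IsSimple.irrefl simpleH y) (==-refl y) ⟩
    ((a == b) ∧ false) ∨ (G a b ∧ true)      ≡⟨ cong₂ _∨_ (∧-zeroʳ (a == b)) (∧-identityʳ (G a b)) ⟩
    G a b                                    ∎
    where open ≡-Reasoning

  columns : LineDecomposition (G □ H)
  columns = record
    { L = m ; K = n ; Line = H
    ; pt             = combine
    ; line           = proj₁ ∘ remQuot {m} n
    ; coord          = proj₂ ∘ remQuot {m} n
    ; line-pt        = λ x y → cong proj₁ (remQuot-combine x y)
    ; coord-pt       = λ x y → cong proj₂ (remQuot-combine x y)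
    ; pt-line-coord  = combine-remQuot {m} n
    ; along          = column-adjacency
    ; Line-irrefl    = IsSimple.irrefl simpleH
    ; Line-connected = connH
    }

  rows : LineDecomposition (G □ H)
  rows = record
    { L = n ; K = m ; Line = G
    ; pt             = λ y x → combine x y
    ; line           = proj₂ ∘ remQuot {m} n
    ; coord          = proj₁ ∘ remQuot {m} n
    ; line-pt        = λ y x → cong proj₂ (remQuot-combine x y)
    ; coord-pt       = λ y x → cong proj₁ (remQuot-combine x y)
    ; pt-line-coord  = combine-remQuot {m} n
    ; along          = row-adjacency
    ; Line-irrefl    = IsSimple.irrefl simpleG
    ; Line-connected = connG
    }

  □-neighbour-aligned : ∀ w x y → (G □ H) w (combine x y) ≡ true →
    proj₁ (remQuot {m} n w) ≡ x ⊎ proj₂ (remQuot {m} n w) ≡ y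
  □-neighbour-aligned w x y adj
    with ∨-true _ (trans (sym (□-combine _ _ x y))
                         (subst (λ u → (G □ H) u (combine x y) ≡ true) (sym (combine-remQuot {m} n w)) adj))
  ... | inj₁ same-column = inj₁ (==⇒≡ (∧-conicalˡ _ _ same-column))
  ... | inj₂ same-row    = inj₂ (==⇒≡ (∧-conicalʳ _ _ same-row))

  module _ (k : ℕ) {s : ℕ} (layout : Fin s → Fin (m * n)) where
    open Play (G □ H) k layout
    open Invariant
    module C = Lines columns k layout
    module R = Lines rows k layout

    crossing-unprotected : ∀ {st F x y} → Invariant st F → C.UntouchedLine F x → R.UntouchedLine F y →
      prot st (combine x y) ≡ false
    crossing-unprotected {st} {F} {x} {y} I column row = ¬-not reached
      where
      unfired : ∀ u → F (combine (proj₁ (remQuot {m} n u)) (proj₂ (remQuot {m} n u))) ≡ false → F u ≡ false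
      unfired u = subst (λ w → F w ≡ false) (combine-remQuot {m} n u)
      reached : prot st (combine x y) ≢ true
      reached p with protected⇒reached I _ p
      ... | inj₁ initial = not-¬ (proj₂ (column y)) initial
      ... | inj₂ (u , Fu , adj) with □-neighbour-aligned u x y adj
      ...   | inj₁ refl = not-¬ (unfired u (proj₁ (column _))) Fu
      ...   | inj₂ refl = not-¬ (unfired u (proj₁ (row _))) Fu

    nothing-fired : ∀ {st F} → Invariant st F → (∀ w → prot st w ≡ true) →
      C.Untouched F → R.Untouched F → ∀ w → F w ≡ false
    nothing-fired _ _ (inj₁ none) _           = none
    nothing-fired _ _ (inj₂ _)    (inj₁ none) = none
    nothing-fired I all-protected (inj₂ (_ , column)) (inj₂ (_ , row)) =
      ⊥-elim (not-¬ (crossing-unprotected I column row) (all-protected _))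

    every-column-unfired : ∀ {F} → Fin n → R.Untouched F → ∀ x → ∃ λ y → F (combine x y) ≡ false
    every-column-unfired y₀ (inj₁ none)     x = y₀ , none _
    every-column-unfired _  (inj₂ (y , row)) x = y , proj₁ (row x)

    every-row-unfired : ∀ {F} → Fin m → C.Untouched F → ∀ y → ∃ λ x → F (combine x y) ≡ false
    every-row-unfired x₀ (inj₁ none)        y = x₀ , none _
    every-row-unfired _  (inj₂ (x , column)) y = x , proj₁ (column y)

    run-bound : ∀ {st fin F} → Fin m → Fin n → Star (Step (G □ H) k) st fin → (∀ w → prot fin w ≡ true) →
      Invariant st F → C.Untouched F → R.Untouched F → (m ∸ 1) + δ H ≤ s ⊎ (n ∸ 1) + δ G ≤ s
    run-bound {fin = fin} x₀ y₀ ε all-protected I uc ur = inj₁ (C.saturated-bound fin x₀ y₀ λ w →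
      unfired⇒occupied I w (all-protected w) (nothing-fired I all-protected uc ur w))
    run-bound x₀ y₀ (stage ◅ rest) all-protected I uc ur with C.advance I uc | R.advance I ur
    ... | inj₁ (covered , fresh) | _  = inj₁ (C.fresh-firing-bound I (every-column-unfired y₀ ur) covered fresh)
    ... | inj₂ _ | inj₁ (covered , fresh) = inj₂ (R.fresh-firing-bound I (every-row-unfired x₀ uc) covered fresh)
    ... | inj₂ uc′ | inj₂ ur′ = run-bound x₀ y₀ rest all-protected (invariant-step stage I) uc′ ur′

theorem4p1 : (m n : ℕ) → 2 ≤ m → m ≤ n →
    (G : Adjacency m) → (H : Adjacency n) →
    IsSimple G → IsSimple H → Connected G → Connected H →
    (k : ℕ) → 1 ≤ k →
    (s : ℕ) → (layout : Fin s → Fin (m * n)) → Successful (G □ H) k layout →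
    ((n + δ G) ∸ 1) ⊓ ((m + δ H) ∸ 1) ≤ s
theorem4p1 (suc (suc m)) (suc n) (s≤s (s≤s _)) (s≤s _) G H simpleG simpleH connG connH k _ s layout (fin , play , all-protected) =
  [ ≤-trans (m⊓n≤n _ _) , ≤-trans (m⊓n≤m _ _) ]′
    (run-bound simpleG simpleH connG connH k layout zero zero play all-protected
      (Play.invariant-initial (G □ H) k layout) (inj₁ λ _ → refl) (inj₁ λ _ → refl))
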